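{- Fix a monitoring window $k\ge1$. Let $\tau$ be a monitoring tree (of a blockchain run reachable from an initial run via $\mathsf{step}$) and let $m$ be the number of monitored transactions in $\tau$ (so $m\le k$). Then the number of nodes of $\tau$ is in $\mathcal O(2^m\times k)$.
   Context: A transaction-execution function $\mathsf{applyTx}(t,n)$, applied to a transaction $t$ and configuration $n$, returns $\mathrm{commit}(n_c)$, $\mathrm{fail}(n_f)$, or $\mathrm{pending}(n_c,n_f)$; a transaction is monitored if it activates a future monitor, in which case $\mathsf{applyTx}$ returns $\mathrm{pending}(n_c,n_f)$ (two possible outcomes); an unmonitored transaction yields a single outcome. A monitoring tree is a finite rooted directed tree whose nodes are configurations; each internal node $n$ has one or two children, all edges out of $n$ are labelled by the same transaction; each level corresponds to one pending transaction. Trees are built from a single initial configuration by $\mathsf{step}((H,\tau),t)$, which first applies $\mathsf{extend}(\tau,t)$ (to each leaf $l$ attach one child if $\mathsf{applyTx}(t,l)$ is $\mathrm{commit}$ or $\mathrm{fail}$, and two children $l_c,l_f$ if it is $\mathrm{pending}(l_c,l_f)$) and then, if the resulting height exceeds $k$, replaces the tree by one of the (pruned) successor subtrees of its root, removing the root level; consequently monitoring trees have height at most $k$ and all internal nodes have at most two children, with branching only at levels of monitored transactions. -}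

module Defs where

open import Data.Nat using (ℕ; zero; suc; _+_; _⊔_; _<_)
open import Data.Bool using (Bool; true; false)
open import Data.List using (List; []; _∷_; length; filter)
open import Data.Bool using (T)
open import Relation.Binary.PropositionalEquality using (_≡_)

data Outcome (Config : Set) : Set where
  commit  : Config → Outcome Config
  fail    : Config → Outcome Config
  pending : Config → Config → Outcome Config   -- pending (n_c , n_f)

isPending : {Config : Set} → Outcome Config → Bool
isPending (commit _)    = false
isPending (fail _)      = false
isPending (pending _ _) = true

record System : Set₁ where
  field
    Config     : Set
    Tx         : Set
    applyTx    : Tx → Config → Outcome Config
    monitored  : Tx → Bool
    monitored-pending : ∀ t n → isPending (applyTx t n) ≡ monitored t

module _ (S : System) where
  open System S

  data MTree : Set
  data Children : Set

  data MTree where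
    node : Config → Children → MTree

  data Children where
    leaf : Children
    one  : Tx → MTree → Children
    two  : Tx → MTree → MTree → Children

  size : MTree → ℕ
  size (node _ leaf)        = 1
  size (node _ (one _ a))   = suc (size a)
  size (node _ (two _ a b)) = suc (size a + size b)

  height : MTree → ℕ
  height (node _ leaf)        = 0
  height (node _ (one _ a))   = suc (height a)
  height (node _ (two _ a b)) = suc (height a ⊔ height b)

  extend : MTree → Tx → MTree
  extend (node n leaf) t with applyTx t n
  ... | commit nc     = node n (one t (node nc leaf))
  ... | fail nf       = node n (one t (node nf leaf))
  ... | pending nc nf = node n (two t (node nc leaf) (node nf leaf))
  extend (node n (one t' a)) t   = node n (one t' (extend a t))
  extend (node n (two t' a b)) t = node n (two t' (extend a t) (extend b t))

  data SubtreeOfRoot : MTree → MTree → Set where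
    sub-one  : ∀ {n t a}   → SubtreeOfRoot (node n (one t a)) a
    sub-twoˡ : ∀ {n t a b} → SubtreeOfRoot (node n (two t a b)) a
    sub-twoʳ : ∀ {n t a b} → SubtreeOfRoot (node n (two t a b)) b

  -- step (with monitoring window k) as a relation τ ─[t]→ τ'
  -- (the choice of successor subtree when pruning is nondeterministic)
  data Step (k : ℕ) (τ : MTree) (t : Tx) : MTree → Set where
    step-keep  : height (extend τ t) Data.Nat.≤ k → Step k τ t (extend τ t)
    step-prune : ∀ {τ'} → k < height (extend τ t)
               → SubtreeOfRoot (extend τ t) τ' → Step k τ t τ'

  data Reachable (k : ℕ) : MTree → Set where
    init : (n₀ : Config) → Reachable k (node n₀ leaf)
    next : ∀ {τ τ'} (t : Tx) → Reachable k τ → Step k τ t τ' → Reachable k τ'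

  -- the pending transactions of τ, one per level (read along the
  -- leftmost path; in a reachable tree all nodes of a level carry the
  -- same transaction label)
  levelTxs : MTree → List Tx
  levelTxs (node _ leaf)        = []
  levelTxs (node _ (one t a))   = t ∷ levelTxs a
  levelTxs (node _ (two t a _)) = t ∷ levelTxs a

  monitoredCount : MTree → ℕ
  monitoredCount τ = length (filter (λ t → Data.Bool._≟_ (monitored t) true) (levelTxs τ))

-- In a reachable tree every level is labelled by a single transaction, and the
-- nodes of a level branch exactly when that transaction is monitored.  Hence level
-- i has at most 2^m nodes, and since pruning keeps the height at most k, there are
-- at most k + 1 ≤ 2k levels.
module Submission where

open import Defs
open import Data.Nat using (ℕ; suc; _+_; _*_; _^_; _≤_; s≤s; z≤n)
open import Data.Nat.Properties
open import Data.Nat.Solver using (module +-*-Solver)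
open import Data.Bool using (true; false)
open import Data.Bool.Properties using (not-¬) renaming (_≟_ to _≟ᵇ_)
open import Data.List using (List; []; _∷_; [_]; _++_; length; filter)
open import Data.List.Properties using (length-++; filter-accept; filter-reject)
open import Relation.Nullary using (Dec)
open import Data.Product using (∃; _×_; _,_)
open import Relation.Binary.PropositionalEquality using (_≡_; refl; sym; cong; subst)

module _ (S : System) where
  open System S

  data Layered : List Tx → MTree S → Set where
    layered-leaf : ∀ {n} → Layered [] (node n leaf)
    layered-one  : ∀ {n t ts a} → monitored t ≡ false → Layered ts a →
                   Layered (t ∷ ts) (node n (one t a))
    layered-two  : ∀ {n t ts a b} → monitored t ≡ true → Layered ts a → Layered ts b →
                   Layered (t ∷ ts) (node n (two t a b))

  monitored? : (t : Tx) → Dec (monitored t ≡ true)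
  monitored? t = monitored t ≟ᵇ true

  countMonitored : List Tx → ℕ
  countMonitored ts = length (filter monitored? ts)

  countMonitored-unmonitored : ∀ {t} ts → monitored t ≡ false →
                               countMonitored (t ∷ ts) ≡ countMonitored ts
  countMonitored-unmonitored ts e = cong length (filter-reject monitored? (not-¬ e))

  countMonitored-monitored : ∀ {t} ts → monitored t ≡ true →
                             countMonitored (t ∷ ts) ≡ suc (countMonitored ts)
  countMonitored-monitored ts e = cong length (filter-accept monitored? e)

  levelTxs-layered : ∀ {ts τ} → Layered ts τ → levelTxs S τ ≡ ts
  levelTxs-layered layered-leaf        = refl
  levelTxs-layered (layered-one _ a)   = cong (_ ∷_) (levelTxs-layered a)
  levelTxs-layered (layered-two _ a _) = cong (_ ∷_) (levelTxs-layered a)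

  height-layered : ∀ {ts τ} → Layered ts τ → height S τ ≡ length ts
  height-layered layered-leaf        = refl
  height-layered (layered-one _ a)   = cong suc (height-layered a)
  height-layered (layered-two _ a b)
    rewrite height-layered a | height-layered b = cong suc (⊔-idem _)

  size-layered : ∀ {ts τ} → Layered ts τ →
                 size S τ ≤ suc (length ts) * 2 ^ countMonitored ts
  size-layered layered-leaf = ≤-refl
  size-layered {t ∷ ts} (layered-one e a)
    rewrite countMonitored-unmonitored ts e =
      +-mono-≤ (m^n>0 2 (countMonitored ts)) (size-layered a)
  size-layered {t ∷ ts} (layered-two {a = a} {b} e la lb)
    rewrite countMonitored-monitored ts e = begin
      suc (size S a + size S b)  ≤⟨ s≤s (+-mono-≤ (size-layered la) (size-layered lb)) ⟩
      suc (suc l * p + suc l * p) ≡⟨ cong suc (double-product l p) ⟩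
      suc (suc l * (2 * p))       ≤⟨ +-monoˡ-≤ _ (m^n>0 2 (suc (countMonitored ts))) ⟩
      2 * p + suc l * (2 * p)     ∎
    where
      open ≤-Reasoning
      open +-*-Solver
      l = length ts
      p = 2 ^ countMonitored ts
      double-product : ∀ l p → suc l * p + suc l * p ≡ suc l * (2 * p)
      double-product = solve 2 (λ l p → (con 1 :+ l) :* p :+ (con 1 :+ l) :* p
                                        := (con 1 :+ l) :* (con 2 :* p)) refl

  extend-layered : ∀ {ts τ} t → Layered ts τ → Layered (ts ++ [ t ]) (extend S τ t)
  extend-layered {τ = node n leaf} t layered-leaf
    with applyTx t n | monitored-pending t n
  ... | commit _    | e = layered-one (sym e) layered-leaf
  ... | fail _      | e = layered-one (sym e) layered-leaf
  ... | pending _ _ | e = layered-two (sym e) layered-leaf layered-leaf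
  extend-layered t (layered-one e a)   = layered-one e (extend-layered t a)
  extend-layered t (layered-two e a b) = layered-two e (extend-layered t a) (extend-layered t b)

  subtree-layered : ∀ {ts τ τ'} → Layered ts τ → SubtreeOfRoot S τ τ' →
                    ∃ λ us → Layered us τ' × suc (length us) ≡ length ts
  subtree-layered (layered-one _ a)   sub-one  = _ , a , refl
  subtree-layered (layered-two _ a _) sub-twoˡ = _ , a , refl
  subtree-layered (layered-two _ _ b) sub-twoʳ = _ , b , refl

  reachable-layered : ∀ {k τ} → Reachable S k τ → ∃ λ ts → Layered ts τ × length ts ≤ k
  reachable-layered (init n₀) = [] , layered-leaf , z≤n
  reachable-layered (next t r (step-keep h)) with reachable-layered r
  ... | ts , lay , _ = ts ++ [ t ] , lay' , subst (_≤ _) (height-layered lay') h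
    where lay' = extend-layered t lay
  reachable-layered {k} (next t r (step-prune _ st)) with reachable-layered r
  ... | ts , lay , ts≤k with subtree-layered (extend-layered t lay) st
  ... | us , lay' , e = us , lay' , ≤-pred (begin
        suc (length us)         ≡⟨ e ⟩
        length (ts ++ [ t ])    ≡⟨ length-++ ts ⟩
        length ts + 1           ≡⟨ +-comm (length ts) 1 ⟩
        suc (length ts)         ≤⟨ s≤s ts≤k ⟩
        suc k                   ∎)
    where open ≤-Reasoning

lemma5 : ∃ λ (C : ℕ) → (S : System) (k : ℕ) → 1 ≤ k →
           (τ : MTree S) → Reachable S k τ →
           size S τ ≤ C * (2 ^ monitoredCount S τ * k)
lemma5 = 2 , bound
  where
    bound : (S : System) (k : ℕ) → 1 ≤ k → (τ : MTree S) → Reachable S k τ →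
            size S τ ≤ 2 * (2 ^ monitoredCount S τ * k)
    bound S k 1≤k τ r with reachable-layered S r
    ... | ts , lay , ts≤k rewrite levelTxs-layered S lay = begin
      size S τ              ≤⟨ size-layered S lay ⟩
      suc (length ts) * p   ≤⟨ *-monoˡ-≤ p (+-mono-≤ 1≤k ts≤k) ⟩
      (k + k) * p           ≡⟨ solve 2 (λ k p → (k :+ k) :* p := con 2 :* (p :* k)) refl k p ⟩
      2 * (p * k)           ∎
      where
        open ≤-Reasoning
        open +-*-Solver
        p = 2 ^ countMonitored S ts
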